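{- Let $\mathbf A$ be a Łukasiewicz near semiring and $\theta$ a congruence on $\mathbf A$. Then for all $a,b\in A$: $a\,\theta\, b$ if and only if $a^{\alpha}b\in[0]_\theta$ and $b^{\alpha}a\in[0]_\theta$.
   Context: An $\iota$-near semiring is an algebra $\langle A,+,\cdot,{}^{\alpha},0,1\rangle$ of type $\langle 2,2,1,0,0\rangle$ such that $\langle A,+\rangle$ is a join semilattice with least element $0$ and greatest element $1$ (order $x\le y$ iff $x+y=y$), $x\cdot1=x=1\cdot x$, $(x+y)\cdot z=xz+yz$, $x0=0x=0$, $(x^{\alpha})^{\alpha}=x$, and $x\le y$ implies $y^{\alpha}\le x^{\alpha}$. A Łukasiewicz near semiring is an $\iota$-near semiring satisfying $(x y^{\alpha})^{\alpha} y^{\alpha}=(y x^{\alpha})^{\alpha} x^{\alpha}$. Juxtaposition $xy$ denotes $x\cdot y$. $[0]_\theta$ is the $\theta$-class of $0$. -}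

module Defs where

open import Level using (Level; suc; _⊔_)
open import Relation.Binary.PropositionalEquality using (_≡_)
open import Relation.Binary.Core using (Rel)
open import Relation.Binary.Structures using (IsEquivalence)

record IotaNearSemiring (a : Level) : Set (suc a) where
  infixl 6 _+_
  infixl 7 _·_
  field
    Carrier : Set a
    _+_     : Carrier → Carrier → Carrier
    _·_     : Carrier → Carrier → Carrier
    _ᵅ      : Carrier → Carrier
    𝟘       : Carrier
    𝟙       : Carrier

  _≤_ : Carrier → Carrier → Set a
  x ≤ y = x + y ≡ y

  field
    +-assoc : ∀ x y z → (x + y) + z ≡ x + (y + z)
    +-comm  : ∀ x y → x + y ≡ y + x
    +-idem  : ∀ x → x + x ≡ x
    𝟘-least   : ∀ x → 𝟘 ≤ x
    𝟙-greatest : ∀ x → x ≤ 𝟙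
    ·-identityʳ : ∀ x → x · 𝟙 ≡ x
    ·-identityˡ : ∀ x → 𝟙 · x ≡ x
    ·-distribʳ-+ : ∀ x y z → (x + y) · z ≡ x · z + y · z
    ·-zeroʳ : ∀ x → x · 𝟘 ≡ 𝟘
    ·-zeroˡ : ∀ x → 𝟘 · x ≡ 𝟘
    ᵅ-involutive : ∀ x → (x ᵅ) ᵅ ≡ x
    ᵅ-antitone   : ∀ x y → x ≤ y → (y ᵅ) ≤ (x ᵅ)

record ŁukasiewiczNearSemiring (a : Level) : Set (suc a) where
  field
    ιNS : IotaNearSemiring a
  open IotaNearSemiring ιNS public
  field
    łukasiewicz : ∀ x y → ((x · (y ᵅ)) ᵅ) · (y ᵅ) ≡ ((y · (x ᵅ)) ᵅ) · (x ᵅ)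

-- A congruence of the algebra: an equivalence relation compatible with
-- all fundamental operations (+, ·, α; constants trivially).
record IsCongruence {a ℓ : Level} (A : IotaNearSemiring a)
                    (θ : Rel (IotaNearSemiring.Carrier A) ℓ) : Set (a ⊔ ℓ) where
  open IotaNearSemiring A
  field
    isEquivalence : IsEquivalence θ
    +-cong : ∀ {x y u v} → θ x y → θ u v → θ (x + u) (y + v)
    ·-cong : ∀ {x y u v} → θ x y → θ u v → θ (x · u) (y · v)
    ᵅ-cong : ∀ {x y} → θ x y → θ (x ᵅ) (y ᵅ)

zeroClass : ∀ {a ℓ} (A : IotaNearSemiring a) →
            Rel (IotaNearSemiring.Carrier A) ℓ → IotaNearSemiring.Carrier A → Set ℓ
zeroClass A θ x = θ x (IotaNearSemiring.𝟘 A)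

-- The argument uses three facts.
--  * In every ι-near semiring the involution swaps the bounds: 0ᵅ = 1 and 1ᵅ = 0
--    (antitonicity plus antisymmetry of the semilattice order).
--  * In a Łukasiewicz near semiring, instantiating the Łukasiewicz identity at
--    y = 1 gives x·xᵅ = 0 (hence xᵅ·x = 0), and instantiating it at xᵅ, yᵅ gives
--    the symmetric form (xᵅ·y)ᵅ·y = (yᵅ·x)ᵅ·x.
--  * For any congruence θ, if z θ 0 then zᵅ·w θ 1·w = w.
-- Forward direction: from x θ y we get xᵅ·y θ xᵅ·x = 0, and symmetrically.
-- Backward direction: if xᵅ·y θ 0 and yᵅ·x θ 0, then
--    y  θ  (xᵅ·y)ᵅ·y  =  (yᵅ·x)ᵅ·x  θ  x.
module Submission where

open import Defs
open import Level using (Level)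
open import Relation.Binary.Core using (Rel)
open import Relation.Binary.Structures using (IsEquivalence)
open import Data.Product using (_×_; _,_)
open import Function.Bundles using (_⇔_; mk⇔)
open import Relation.Binary.PropositionalEquality
  using (_≡_; refl; sym; trans; cong; subst₂; module ≡-Reasoning)

module IotaNearSemiringProperties {a : Level} (A : IotaNearSemiring a) where
  open IotaNearSemiring A

  ≤-antisym : ∀ {x y} → x ≤ y → y ≤ x → x ≡ y
  ≤-antisym {x} {y} x≤y y≤x = begin
    x      ≡⟨ sym y≤x ⟩
    y + x  ≡⟨ +-comm y x ⟩
    x + y  ≡⟨ x≤y ⟩
    y      ∎
    where open ≡-Reasoning

  -- The involution sends the bottom to the top: from 0 ≤ 1ᵅ, antitonicity
  -- gives 1 = 1ᵅᵅ ≤ 0ᵅ.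
  𝟘ᵅ≡𝟙 : 𝟘 ᵅ ≡ 𝟙
  𝟘ᵅ≡𝟙 = ≤-antisym (𝟙-greatest (𝟘 ᵅ)) 𝟙≤𝟘ᵅ
    where
    𝟙≤𝟘ᵅ : 𝟙 ≤ (𝟘 ᵅ)
    𝟙≤𝟘ᵅ = subst₂ _≤_ (ᵅ-involutive 𝟙) refl (ᵅ-antitone 𝟘 (𝟙 ᵅ) (𝟘-least (𝟙 ᵅ)))

  𝟙ᵅ≡𝟘 : 𝟙 ᵅ ≡ 𝟘
  𝟙ᵅ≡𝟘 = trans (cong _ᵅ (sym 𝟘ᵅ≡𝟙)) (ᵅ-involutive 𝟘)

module ŁukasiewiczNearSemiringProperties {a : Level} (A : ŁukasiewiczNearSemiring a) where
  open ŁukasiewiczNearSemiring A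
  open IotaNearSemiringProperties ιNS

  -- An element annihilates its complement on the right: this is the
  -- Łukasiewicz identity at y = 1, where both 1ᵅ-factors collapse to 0.
  x·xᵅ≡𝟘 : ∀ x → x · (x ᵅ) ≡ 𝟘
  x·xᵅ≡𝟘 x = sym (begin
    𝟘                        ≡⟨ sym (·-zeroʳ _) ⟩
    ((x · 𝟘) ᵅ) · 𝟘          ≡⟨ cong (λ t → ((x · t) ᵅ) · t) (sym 𝟙ᵅ≡𝟘) ⟩
    ((x · (𝟙 ᵅ)) ᵅ) · (𝟙 ᵅ)  ≡⟨ łukasiewicz x 𝟙 ⟩
    ((𝟙 · (x ᵅ)) ᵅ) · (x ᵅ)  ≡⟨ cong (λ t → (t ᵅ) · (x ᵅ)) (·-identityˡ (x ᵅ)) ⟩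
    ((x ᵅ) ᵅ) · (x ᵅ)        ≡⟨ cong (_· (x ᵅ)) (ᵅ-involutive x) ⟩
    x · (x ᵅ)                ∎)
    where open ≡-Reasoning

  xᵅ·x≡𝟘 : ∀ x → (x ᵅ) · x ≡ 𝟘
  xᵅ·x≡𝟘 x = trans (cong ((x ᵅ) ·_) (sym (ᵅ-involutive x))) (x·xᵅ≡𝟘 (x ᵅ))

  łukasiewicz-ᵅ : ∀ x y → (((x ᵅ) · y) ᵅ) · y ≡ (((y ᵅ) · x) ᵅ) · x
  łukasiewicz-ᵅ x y =
    subst₂ (λ s t → (((x ᵅ) · s) ᵅ) · s ≡ (((y ᵅ) · t) ᵅ) · t)
      (ᵅ-involutive y) (ᵅ-involutive x) (łukasiewicz (x ᵅ) (y ᵅ))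

module CongruenceProperties {a ℓ : Level} (A : IotaNearSemiring a)
    (θ : Rel (IotaNearSemiring.Carrier A) ℓ) (isCongruence : IsCongruence A θ) where
  open IotaNearSemiring A
  open IotaNearSemiringProperties A
  open IsCongruence isCongruence
  open IsEquivalence isEquivalence public
    renaming (refl to θ-refl; sym to θ-sym; trans to θ-trans)

  ≡⇒θ : ∀ {u v} → u ≡ v → θ u v
  ≡⇒θ refl = θ-refl

  -- Multiplying on the left by the complement of an element of [0]_θ acts as
  -- the identity modulo θ: zᵅ·w θ 0ᵅ·w = 1·w = w.
  complement-of-zeroClass-·ˡ : ∀ {z} w → zeroClass A θ z → θ ((z ᵅ) · w) w
  complement-of-zeroClass-·ˡ w z∈[0] =
    θ-trans (·-cong (θ-trans (ᵅ-cong z∈[0]) (≡⇒θ 𝟘ᵅ≡𝟙)) θ-refl) (≡⇒θ (·-identityˡ w))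

lemma1 : ∀ {a ℓ} (A : ŁukasiewiczNearSemiring a)
           (θ : Rel (ŁukasiewiczNearSemiring.Carrier A) ℓ) →
           IsCongruence (ŁukasiewiczNearSemiring.ιNS A) θ →
           ∀ x y →
           θ x y ⇔
             (zeroClass (ŁukasiewiczNearSemiring.ιNS A) θ
                (ŁukasiewiczNearSemiring._·_ A (ŁukasiewiczNearSemiring._ᵅ A x) y)
              × zeroClass (ŁukasiewiczNearSemiring.ιNS A) θ
                (ŁukasiewiczNearSemiring._·_ A (ŁukasiewiczNearSemiring._ᵅ A y) x))
lemma1 A θ isCongruence x y = mk⇔ related⇒differencesVanish differencesVanish⇒related
  where
  open ŁukasiewiczNearSemiring A
  open ŁukasiewiczNearSemiringProperties A
  open CongruenceProperties ιNS θ isCongruence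
  open IsCongruence isCongruence using (·-cong)

  related⇒differencesVanish : θ x y → θ ((x ᵅ) · y) 𝟘 × θ ((y ᵅ) · x) 𝟘
  related⇒differencesVanish x~y =
      θ-trans (·-cong θ-refl (θ-sym x~y)) (≡⇒θ (xᵅ·x≡𝟘 x))
    , θ-trans (·-cong θ-refl x~y) (≡⇒θ (xᵅ·x≡𝟘 y))

  differencesVanish⇒related : θ ((x ᵅ) · y) 𝟘 × θ ((y ᵅ) · x) 𝟘 → θ x y
  differencesVanish⇒related (xᵅy∈[0] , yᵅx∈[0]) =
    θ-trans (θ-sym (complement-of-zeroClass-·ˡ x yᵅx∈[0]))
      (θ-trans (≡⇒θ (sym (łukasiewicz-ᵅ x y)))
        (complement-of-zeroClass-·ˡ y xᵅy∈[0]))
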